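{- For all integers $k\geq 3$, we have $\Gamma(k)\leq 3k-4$. Furthermore, $\displaystyle\limsup_{k\to\infty}\frac{\Gamma(k)}{k}=3$.
   Context: The Thue-Morse word is the infinite binary word ${\bf t}={\bf t}_1{\bf t}_2{\bf t}_3\cdots$, where ${\bf t}_i\in\{0,1\}$ has the same parity as the number of $1$'s in the binary expansion of $i-1$ (so ${\bf t}=0110100110010110\cdots$). A $k$-anti-power is a word of the form $w_1w_2\cdots w_k$ where $w_1,\ldots,w_k$ are pairwise distinct words all of the same length. Let $\mathcal F(k)$ denote the set of odd positive integers $m$ such that the prefix of ${\bf t}$ of length $km$ is a $k$-anti-power. Define $\Gamma(k)=\sup\big((2\mathbb Z^+-1)\setminus\mathcal F(k)\big)$, the supremum of the set of odd positive integers not in $\mathcal F(k)$. -}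

module Defs where

open import Data.Bool using (Bool; true; false; not; _xor_)
open import Data.Nat using (ℕ; zero; suc; _+_; _*_; _≡ᵇ_; _<_)
open import Data.Nat.DivMod using (_/_; _%_)
open import Data.Fin using (Fin; toℕ)
open import Data.Vec using (Vec; tabulate)
open import Relation.Binary.PropositionalEquality using (_≡_; _≢_)

-- Parity of the number of 1's in the binary expansion of n, computed with
-- fuel f (fuel n suffices, since halving n at most n times reaches 0).
parityFuel : ℕ → ℕ → Bool
parityFuel zero    n = false
parityFuel (suc f) n = (n % 2 ≡ᵇ 1) xor parityFuel f (n / 2)

-- Thue–Morse word, 0-indexed: tm i = 𝐭_{i+1}, true ↔ letter 1.
-- 𝐭_{i+1} has the parity of the number of 1's in binary expansion of i.
tm : ℕ → Bool
tm i = parityFuel i i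

-- The i-th block (0-indexed) of length m of the Thue–Morse word:
-- w_{i+1} = 𝐭_{im+1} ⋯ 𝐭_{im+m}.
block : (m : ℕ) → ℕ → Vec Bool m
block m i = tabulate (λ j → tm (i * m + toℕ j))

-- The prefix of 𝐭 of length k·m is a k-anti-power:
-- its k consecutive blocks of length m are pairwise distinct.
PrefixAntiPower : ℕ → ℕ → Set
PrefixAntiPower k m = ∀ i j → i < k → j < k → i ≢ j → block m i ≢ block m j

-- If blocks i < j of odd length m coincide and j − i = 2^v·d with d odd, then 𝐭 has
-- equal factors of length m at two positions differing by an odd multiple of 2^v.
-- Since 𝐭(2x) = 𝐭(x) and 𝐭(2x+1) = ¬𝐭(x), halving v times leaves equal factors at
-- positions of different parity, and four letters of those would force a factor aaa,
-- which 𝐭 avoids.  Hence m ≤ 3·2^v ≤ 3(k − 1), and the parity of m sharpens this to 3k − 4.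
--
-- Conversely, for t = 4^g − 1 and a large power of two u, the odd length
-- m = u(12t + 11) − 1 makes blocks 8t + 7 and 8t + 7 + 4(t + 1)u coincide: both are the
-- same window in the images, under the 2^n-uniform Thue–Morse morphism, of the equal
-- factors of length 3 at 24t + 19 and 24t + 19 + m.  With k = (u + 2)·4(t + 1) the ratio
-- m/k tends to 3 − 1/(4(t + 1)) as u grows.

module Submission where

open import Defs
open import Data.Bool using (true; false; not; _xor_)
open import Data.Bool.Properties using (not-injective; not-involutive; not-¬; xor-assoc; xor-comm)
open import Data.Empty using (⊥)
open import Data.Fin using (toℕ; fromℕ<)
open import Data.Fin.Properties using (toℕ-fromℕ<; toℕ<n)
open import Data.Nat
open import Data.Nat.DivMod
open import Data.Nat.Induction using (<-wellFounded)
open import Data.Nat.Properties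
open import Data.Nat.Tactic.RingSolver using (solve-∀)
open import Data.Product using (_×_; _,_; ∃-syntax)
open import Data.Vec using (lookup)
open import Data.Vec.Properties using (lookup∘tabulate; tabulate-cong)
open import Induction.WellFounded using (Acc; acc)
open import Relation.Binary.Definitions using (tri<; tri≈; tri>)
open import Relation.Binary.PropositionalEquality
open import Relation.Nullary using (¬_)

data Halving : ℕ → Set where
  even : ∀ y → Halving (2 * y)
  odd  : ∀ y → Halving (1 + 2 * y)

halving : ∀ x → Halving x
halving zero = even 0
halving (suc x) with halving x
... | even y = odd y
... | odd y  = subst Halving (*-suc 2 y) (even (suc y))

parityFuel-zero : ∀ f → parityFuel f 0 ≡ false
parityFuel-zero zero    = refl
parityFuel-zero (suc f) = parityFuel-zero f

n/2≤pred[n] : ∀ n → n / 2 ≤ pred n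
n/2≤pred[n] zero      = z≤n
n/2≤pred[n] n@(suc _) = <⇒≤pred (m/n<m n 2 (s≤s (s≤s z≤n)))

parityFuel-stable : ∀ {f f' n} → n ≤ f → n ≤ f' → parityFuel f n ≡ parityFuel f' n
parityFuel-stable {zero}  {f'}     z≤n _   = sym (parityFuel-zero f')
parityFuel-stable {suc f} {zero}   _   z≤n = parityFuel-zero (suc f)
parityFuel-stable {suc f} {suc f'} {n} n≤1+f n≤1+f' =
  cong ((n % 2 ≡ᵇ 1) xor_) (parityFuel-stable (halve n≤1+f) (halve n≤1+f'))
  where
  halve : ∀ {g} → n ≤ suc g → n / 2 ≤ g
  halve n≤1+g = ≤-trans (n/2≤pred[n] n) (pred-mono-≤ n≤1+g)

tm-unfold : ∀ n → tm n ≡ (n % 2 ≡ᵇ 1) xor tm (n / 2)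
tm-unfold zero        = refl
tm-unfold n@(suc _)   = cong ((n % 2 ≡ᵇ 1) xor_) (parityFuel-stable (n/2≤pred[n] n) ≤-refl)

tm-bit+2* : ∀ b x → b < 2 → tm (b + 2 * x) ≡ (b ≡ᵇ 1) xor tm x
tm-bit+2* b x b<2 = begin
  tm (b + 2 * x)                                   ≡⟨ cong (λ y → tm (b + y)) (*-comm 2 x) ⟩
  tm (b + x * 2)                                   ≡⟨ tm-unfold (b + x * 2) ⟩
  ((b + x * 2) % 2 ≡ᵇ 1) xor tm ((b + x * 2) / 2) ≡⟨ cong₂ (λ c y → (c ≡ᵇ 1) xor tm y) remainder quotient ⟩
  (b ≡ᵇ 1) xor tm x                                ∎
  where
  open ≡-Reasoning
  remainder : (b + x * 2) % 2 ≡ b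
  remainder = trans ([m+kn]%n≡m%n b x 2) (m<n⇒m%n≡m b<2)
  remainders<2 : b % 2 + x * 2 % 2 < 2
  remainders<2 = subst (_< 2) (sym (trans (cong₂ _+_ (m<n⇒m%n≡m b<2) (m*n%n≡0 x 2)) (+-identityʳ b))) b<2
  quotient : (b + x * 2) / 2 ≡ x
  quotient = begin
    (b + x * 2) / 2     ≡⟨ +-distrib-/ b (x * 2) remainders<2 ⟩
    b / 2 + x * 2 / 2   ≡⟨ cong₂ _+_ (m<n⇒m/n≡0 b<2) (m*n/n≡m x 2) ⟩
    x                   ∎

tm-2* : ∀ x → tm (2 * x) ≡ tm x
tm-2* x = tm-bit+2* 0 x (s≤s z≤n)

tm-1+2* : ∀ x → tm (1 + 2 * x) ≡ not (tm x)
tm-1+2* x = tm-bit+2* 1 x (s≤s (s≤s z≤n))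

x≡x%2+2*[x/2] : ∀ x → x ≡ x % 2 + 2 * (x / 2)
x≡x%2+2*[x/2] x = trans (m≡m%n+[m/n]*n x 2) (cong (x % 2 +_) (*-comm (x / 2) 2))

+-2*-halve : ∀ x P y → x + 2 * P * y ≡ x % 2 + 2 * (x / 2 + P * y)
+-2*-halve x P y = trans (cong (_+ 2 * P * y) (x≡x%2+2*[x/2] x)) (regroup (x % 2) (x / 2) P y)
  where
  regroup : ∀ b h P y → b + 2 * h + 2 * P * y ≡ b + 2 * (h + P * y)
  regroup = solve-∀

tm-+-2^n* : ∀ n x y → x < 2 ^ n → tm (x + 2 ^ n * y) ≡ tm x xor tm y
tm-+-2^n* zero    zero    y _ = cong tm (+-identityʳ y)
tm-+-2^n* zero    (suc x) y (s≤s ())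
tm-+-2^n* (suc n) x       y x<2^[1+n] = begin
  tm (x + 2 ^ suc n * y)                   ≡⟨ cong tm (+-2*-halve x (2 ^ n) y) ⟩
  tm (x % 2 + 2 * (x / 2 + 2 ^ n * y))     ≡⟨ tm-bit+2* (x % 2) (x / 2 + 2 ^ n * y) (m%n<n x 2) ⟩
  (x % 2 ≡ᵇ 1) xor tm (x / 2 + 2 ^ n * y)  ≡⟨ cong ((x % 2 ≡ᵇ 1) xor_) (tm-+-2^n* n (x / 2) y x/2<2^n) ⟩
  (x % 2 ≡ᵇ 1) xor (tm (x / 2) xor tm y)   ≡⟨ sym (xor-assoc (x % 2 ≡ᵇ 1) (tm (x / 2)) (tm y)) ⟩
  ((x % 2 ≡ᵇ 1) xor tm (x / 2)) xor tm y   ≡⟨ cong (_xor tm y) (sym (tm-unfold x)) ⟩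
  tm x xor tm y                            ∎
  where
  open ≡-Reasoning
  x/2<2^n : x / 2 < 2 ^ n
  x/2<2^n = m<n*o⇒m/o<n (subst (x <_) (*-comm 2 (2 ^ n)) x<2^[1+n])

tm-+-2^n*-flip : ∀ n x y → tm y ≡ true → x < 2 ^ n → tm (x + 2 ^ n * y) ≡ not (tm x)
tm-+-2^n*-flip n x y tm[y] x<2^n = begin
  tm (x + 2 ^ n * y) ≡⟨ tm-+-2^n* n x y x<2^n ⟩
  tm x xor tm y      ≡⟨ cong (tm x xor_) tm[y] ⟩
  tm x xor true      ≡⟨ xor-comm (tm x) true ⟩
  not (tm x)         ∎
  where open ≡-Reasoning

tm-no-aaa : ∀ c → tm c ≡ tm (1 + c) → tm (1 + c) ≡ tm (2 + c) → ⊥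
tm-no-aaa c with halving c
... | even y = λ tm[2y]≡tm[1+2y] _ → not-¬ refl (begin
  tm y            ≡⟨ tm-2* y ⟨
  tm (2 * y)      ≡⟨ tm[2y]≡tm[1+2y] ⟩
  tm (1 + 2 * y)  ≡⟨ tm-1+2* y ⟩
  not (tm y)      ∎)
  where open ≡-Reasoning
... | odd y  = λ _ tm[2+2y]≡tm[3+2y] → not-¬ refl (begin
  tm (1 + y)            ≡⟨ tm-2* (1 + y) ⟨
  tm (2 * (1 + y))      ≡⟨ cong tm (*-suc 2 y) ⟩
  tm (2 + 2 * y)        ≡⟨ tm[2+2y]≡tm[3+2y] ⟩
  tm (3 + 2 * y)        ≡⟨ cong (λ x → tm (1 + x)) (*-suc 2 y) ⟨
  tm (1 + 2 * (1 + y))  ≡⟨ tm-1+2* (1 + y) ⟩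
  not (tm (1 + y))      ∎)
  where open ≡-Reasoning

xor-cancelˡ : ∀ a {b c} → a xor b ≡ a xor c → b ≡ c
xor-cancelˡ false eq = eq
xor-cancelˡ true  eq = not-injective eq

record Agree (p q L : ℕ) : Set where
  constructor agreement
  field letter : ∀ x → x < L → tm (p + x) ≡ tm (q + x)
open Agree

agree-cong : ∀ {p p' q q' L L'} → p ≡ p' → q ≡ q' → L ≡ L' → Agree p q L → Agree p' q' L'
agree-cong refl refl refl ag = ag

agree-sym : ∀ {p q L} → Agree p q L → Agree q p L
agree-sym ag = agreement λ x x<L → sym (letter ag x x<L)

agree-shorten : ∀ {p q L L'} → L' ≤ L → Agree p q L → Agree p q L'
agree-shorten L'≤L ag = agreement λ x x<L' → letter ag x (<-≤-trans x<L' L'≤L)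

agree-drop : ∀ {p q} s {L} → Agree p q (s + L) → Agree (p + s) (q + s) L
agree-drop {p} {q} s ag = agreement λ x x<L →
  subst₂ (λ a b → tm a ≡ tm b) (sym (+-assoc p s x)) (sym (+-assoc q s x))
         (letter ag (s + x) (+-monoʳ-< s x<L))

agree-halve : ∀ b {c c' L} → b < 2 → Agree (b + 2 * c) (b + 2 * c') (suc (2 * L)) → Agree c c' (suc L)
agree-halve b {c} {c'} b<2 ag = agreement λ x x≤L → xor-cancelˡ (b ≡ᵇ 1) (begin
  (b ≡ᵇ 1) xor tm (c + x)   ≡⟨ sym (tm-bit+2* b (c + x) b<2) ⟩
  tm (b + 2 * (c + x))      ≡⟨ cong tm (regroup b c x) ⟩
  tm (b + 2 * c + 2 * x)    ≡⟨ letter ag (2 * x) (s≤s (*-monoʳ-≤ 2 (≤-pred x≤L))) ⟩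
  tm (b + 2 * c' + 2 * x)   ≡⟨ cong tm (sym (regroup b c' x)) ⟩
  tm (b + 2 * (c' + x))     ≡⟨ tm-bit+2* b (c' + x) b<2 ⟩
  (b ≡ᵇ 1) xor tm (c' + x)  ∎)
  where
  open ≡-Reasoning
  regroup : ∀ b c x → b + 2 * (c + x) ≡ b + 2 * c + 2 * x
  regroup = solve-∀

agree-scale : ∀ n {a b c} → Agree a b c → Agree (a * 2 ^ n) (b * 2 ^ n) (c * 2 ^ n)
agree-scale n {a} {b} ag = agreement λ y y<c*P → begin
  tm (a * P + y)                 ≡⟨ cong tm (regroup a y) ⟩
  tm (y % P + P * (a + y / P))   ≡⟨ tm-+-2^n* n (y % P) (a + y / P) (m%n<n y P) ⟩
  tm (y % P) xor tm (a + y / P)  ≡⟨ cong (tm (y % P) xor_) (letter ag (y / P) (m<n*o⇒m/o<n y<c*P)) ⟩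
  tm (y % P) xor tm (b + y / P)  ≡⟨ tm-+-2^n* n (y % P) (b + y / P) (m%n<n y P) ⟨
  tm (y % P + P * (b + y / P))   ≡⟨ cong tm (regroup b y) ⟨
  tm (b * P + y)                 ∎
  where
  open ≡-Reasoning
  P = 2 ^ n
  instance
    P≢0 : NonZero P
    P≢0 = m^n≢0 2 n
  regroup : ∀ a y → a * P + y ≡ y % P + P * (a + y / P)
  regroup a y = trans (cong (a * P +_) (m≡m%n+[m/n]*n y P)) (regroup′ a (y % P) (y / P) P)
    where
    regroup′ : ∀ a r q P → a * P + (r + q * P) ≡ r + P * (a + q)
    regroup′ = solve-∀

agree-pair⇒tm-constant : ∀ c c' → Agree (2 * c) (1 + 2 * c') 2 → tm c' ≡ tm (1 + c')
agree-pair⇒tm-constant c c' ag = begin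
  tm c'                  ≡⟨ not-involutive (tm c') ⟨
  not (not (tm c'))      ≡⟨ cong not (tm-1+2* c') ⟨
  not (tm (1 + 2 * c'))  ≡⟨ cong not (letter-at 0 (s≤s z≤n)) ⟨
  not (tm (2 * c))       ≡⟨ cong not (tm-2* c) ⟩
  not (tm c)             ≡⟨ tm-1+2* c ⟨
  tm (1 + 2 * c)         ≡⟨ letter-at 1 (s≤s (s≤s z≤n)) ⟩
  tm (2 + 2 * c')        ≡⟨ cong tm (*-suc 2 c') ⟨
  tm (2 * (1 + c'))      ≡⟨ tm-2* (1 + c') ⟩
  tm (1 + c')            ∎
  where
  open ≡-Reasoning
  letter-at : ∀ x → x < 2 → tm (x + 2 * c) ≡ tm (x + (1 + 2 * c'))
  letter-at x x<2 = subst₂ (λ a b → tm a ≡ tm b) (+-comm (2 * c) x) (+-comm (1 + 2 * c') x) (letter ag x x<2)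

¬agree-even-odd : ∀ c c' → ¬ Agree (2 * c) (1 + 2 * c') 4
¬agree-even-odd c c' ag = tm-no-aaa c'
  (agree-pair⇒tm-constant c c' (agree-shorten (s≤s (s≤s z≤n)) ag))
  (agree-pair⇒tm-constant (1 + c) (1 + c') (agree-cong shiftedₑ shiftedₒ refl (agree-drop 2 ag)))
  where
  shiftedₑ : 2 * c + 2 ≡ 2 * (1 + c)
  shiftedₑ = trans (+-comm (2 * c) 2) (sym (*-suc 2 c))
  shiftedₒ : 1 + 2 * c' + 2 ≡ 1 + 2 * (1 + c')
  shiftedₒ = trans (+-comm (1 + 2 * c') 2) (cong suc (sym (*-suc 2 c')))

¬agree-2^n*odd : ∀ n p d → ¬ Agree p (p + 2 ^ n * (1 + 2 * d)) (suc (3 * 2 ^ n))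
¬agree-2^n*odd zero p d ag with halving p
... | even c = ¬agree-even-odd c (c + d) (agree-cong refl (shift c d) refl ag)
  where
  shift : ∀ c d → 2 * c + 1 * (1 + 2 * d) ≡ 1 + 2 * (c + d)
  shift = solve-∀
... | odd c  = ¬agree-even-odd (1 + c + d) c (agree-sym (agree-cong refl (shift c d) refl ag))
  where
  shift : ∀ c d → 1 + 2 * c + 1 * (1 + 2 * d) ≡ 2 * (1 + c + d)
  shift = solve-∀
¬agree-2^n*odd (suc n) p d ag =
  ¬agree-2^n*odd n (p / 2) d
    (agree-halve (p % 2) (m%n<n p 2)
      (agree-cong (x≡x%2+2*[x/2] p) (+-2*-halve p (2 ^ n) (1 + 2 * d)) (doubled (2 ^ n)) ag))
  where
  doubled : ∀ P → suc (3 * (2 * P)) ≡ suc (2 * (3 * P))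
  doubled = solve-∀

agree-2^n*odd-length : ∀ n {p} d {L} → Agree p (p + 2 ^ n * (1 + 2 * d)) L → L ≤ 3 * 2 ^ n
agree-2^n*odd-length n {p} d ag = ≮⇒≥ λ long → ¬agree-2^n*odd n p d (agree-shorten long ag)

block-≡⇒agree : ∀ m i j → block m i ≡ block m j → Agree (i * m) (j * m) m
block-≡⇒agree m i j eq = agreement λ x x<m → begin
  tm (i * m + x)                  ≡⟨ letter-of i x<m ⟨
  lookup (block m i) (fromℕ< x<m) ≡⟨ cong (λ w → lookup w (fromℕ< x<m)) eq ⟩
  lookup (block m j) (fromℕ< x<m) ≡⟨ letter-of j x<m ⟩
  tm (j * m + x)                  ∎
  where
  open ≡-Reasoning
  letter-of : ∀ k {x} (x<m : x < m) → lookup (block m k) (fromℕ< x<m) ≡ tm (k * m + x)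
  letter-of k x<m = trans (lookup∘tabulate _ (fromℕ< x<m)) (cong (λ y → tm (k * m + y)) (toℕ-fromℕ< x<m))

agree⇒block-≡ : ∀ m i j → Agree (i * m) (j * m) m → block m i ≡ block m j
agree⇒block-≡ m i j ag = tabulate-cong λ x → letter ag (toℕ x) (toℕ<n x)

2^v*odd-decomposition : ∀ e → 0 < e → ∃[ v ] ∃[ d ] e ≡ 2 ^ v * (1 + 2 * d)
2^v*odd-decomposition e = go e (<-wellFounded e)
  where
  go : ∀ e → Acc _<_ e → 0 < e → ∃[ v ] ∃[ d ] e ≡ 2 ^ v * (1 + 2 * d)
  go e _ 0<e with halving e
  go _ _         _   | odd d         = 0 , d , sym (+-identityʳ _)
  go _ _         ()  | even zero
  go _ (acc rec) _   | even y@(suc _) with go y (rec (m<m+n y (s≤s z≤n))) (s≤s z≤n)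
  ... | v , d , y≡2^v*odd = suc v , d , trans (cong (2 *_) y≡2^v*odd) (sym (*-assoc 2 (2 ^ v) (1 + 2 * d)))

equal-odd-blocks⇒short : ∀ r {i j} → i < j → block (suc (2 * r)) i ≡ block (suc (2 * r)) j →
                         ∃[ v ] (i + 2 ^ v ≤ j × suc (2 * r) ≤ 3 * 2 ^ v)
equal-odd-blocks⇒short r {i} {j} i<j eq with 2^v*odd-decomposition (j ∸ i) (m<n⇒0<n∸m i<j)
... | v , d , j∸i≡2^v*odd =
  v , i+2^v≤j ,
  agree-2^n*odd-length v (2 * d * r + d + r) (agree-cong refl j*m≡i*m+2^v*odd refl (block-≡⇒agree m i j eq))
  where
  m = suc (2 * r)
  j≡i+2^v*odd : j ≡ i + 2 ^ v * (1 + 2 * d)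
  j≡i+2^v*odd = trans (sym (m+[n∸m]≡n (<⇒≤ i<j))) (cong (i +_) j∸i≡2^v*odd)
  i+2^v≤j : i + 2 ^ v ≤ j
  i+2^v≤j = subst (i + 2 ^ v ≤_) (sym j≡i+2^v*odd) (+-monoʳ-≤ i (m≤m*n (2 ^ v) (1 + 2 * d)))
  j*m≡i*m+2^v*odd : j * m ≡ i * m + 2 ^ v * (1 + 2 * (2 * d * r + d + r))
  j*m≡i*m+2^v*odd = trans (cong (_* m) j≡i+2^v*odd) (expand i (2 ^ v) d r)
    where
    expand : ∀ i P d r → (i + P * (1 + 2 * d)) * suc (2 * r) ≡ i * suc (2 * r) + P * (1 + 2 * (2 * d * r + d + r))
    expand = solve-∀

-- For v ≥ 1 the bound 3·2^v is even, so the odd m is at most 3·2^v − 1 ≤ 3k − 4.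
odd≤3*2^v⇒≤3k∸4 : ∀ v r k → 3 ≤ k → 2 ^ v < k → suc (2 * r) ≤ 3 * 2 ^ v → suc (2 * r) ≤ 3 * k ∸ 4
odd≤3*2^v⇒≤3k∸4 v r k@(suc (suc (suc k'))) (s≤s (s≤s (s≤s _))) 2^v<k m≤3*2^v =
  subst (suc (2 * r) ≤_) (sym 3k∸4≡5+3k') (bound v 2^v<k m≤3*2^v)
  where
  3k∸4≡5+3k' : 3 * k ∸ 4 ≡ 5 + 3 * k'
  3k∸4≡5+3k' = trans (cong (_∸ 4) (expand k')) (m+n∸m≡n 4 (5 + 3 * k'))
    where
    expand : ∀ k' → 3 * (3 + k') ≡ 4 + (5 + 3 * k')
    expand = solve-∀
  bound : ∀ v → 2 ^ v < k → suc (2 * r) ≤ 3 * 2 ^ v → suc (2 * r) ≤ 5 + 3 * k'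
  bound zero    _      m≤3 = ≤-trans m≤3 (m≤m+n 3 (2 + 3 * k'))
  bound (suc v) 2P<k m≤6P = ≤-pred (begin
    2 + 2 * r            ≡⟨ *-suc 2 r ⟨
    2 * suc r            ≤⟨ *-monoʳ-≤ 2 r<3*2^v ⟩
    2 * (3 * 2 ^ v)      ≡⟨ 3*2*P≡2*3*P (2 ^ v) ⟨
    3 * 2 ^ suc v        ≤⟨ *-monoʳ-≤ 3 (≤-pred 2P<k) ⟩
    3 * (2 + k')         ≡⟨ expand k' ⟩
    suc (5 + 3 * k')     ∎)
    where
    open ≤-Reasoning
    3*2*P≡2*3*P : ∀ P → 3 * (2 * P) ≡ 2 * (3 * P)
    3*2*P≡2*3*P = solve-∀
    r<3*2^v : r < 3 * 2 ^ v
    r<3*2^v = *-cancelˡ-< 2 r (3 * 2 ^ v) (subst (2 * r <_) (3*2*P≡2*3*P (2 ^ v)) m≤6P)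
    expand : ∀ k' → 3 * (2 + k') ≡ suc (5 + 3 * k')
    expand = solve-∀

equal-odd-blocks⇒≤3k∸4 : ∀ k r {i j} → 3 ≤ k → i < j → j < k →
                          block (suc (2 * r)) i ≡ block (suc (2 * r)) j → suc (2 * r) ≤ 3 * k ∸ 4
equal-odd-blocks⇒≤3k∸4 k r {i} 3≤k i<j j<k eq with equal-odd-blocks⇒short r i<j eq
... | v , i+2^v≤j , m≤3*2^v =
  odd≤3*2^v⇒≤3k∸4 v r k 3≤k (≤-<-trans (m≤n+m (2 ^ v) i) (≤-<-trans i+2^v≤j j<k)) m≤3*2^v

prefixAntiPower-of-long-blocks : ∀ k r → 3 ≤ k → 3 * k ∸ 4 < suc (2 * r) → PrefixAntiPower k (suc (2 * r))
prefixAntiPower-of-long-blocks k r 3≤k long i j i<k j<k i≢j eq with <-cmp i j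
... | tri< i<j _ _ = <⇒≱ long (equal-odd-blocks⇒≤3k∸4 k r 3≤k i<j j<k eq)
... | tri≈ _ i≡j _ = i≢j i≡j
... | tri> _ _ j<i = <⇒≱ long (equal-odd-blocks⇒≤3k∸4 k r 3≤k j<i i<k (sym eq))

Γ≤3k∸4 : ∀ k → 3 ≤ k → ∀ r → ¬ PrefixAntiPower k (suc (2 * r)) → suc (2 * r) ≤ 3 * k ∸ 4
Γ≤3k∸4 k 3≤k r ¬antiPower = ≮⇒≥ λ long → ¬antiPower (prefixAntiPower-of-long-blocks k r 3≤k long)

tm[3+δ]≡not[tm[2+δ]] : ∀ δ → δ < 3 → tm (3 + δ) ≡ not (tm (2 + δ))
tm[3+δ]≡not[tm[2+δ]] 0 _ = refl
tm[3+δ]≡not[tm[2+δ]] 1 _ = refl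
tm[3+δ]≡not[tm[2+δ]] 2 _ = refl
tm[3+δ]≡not[tm[2+δ]] (suc (suc (suc _))) (s≤s (s≤s (s≤s ())))

module EqualBlocks (t h e r : ℕ)
                   (4[1+t]≡2^h : 4 * suc t ≡ 2 ^ h)
                   (tm[3t+2] : tm (3 * t + 2) ≡ true)
                   (1+m≡u*[12t+11] : suc (suc (2 * r)) ≡ 2 ^ suc e * (12 * t + 11))
                   (u-large : 24 * t + 21 ≤ 2 ^ suc e)
                   where

  u H m i j a s n P : ℕ
  u = 2 ^ suc e
  H = 4 * suc t
  m = suc (2 * r)
  i = 8 * t + 7
  j = i + u * H
  a = 24 * t + 19
  s = u ∸ i
  n = suc e + h
  P = 2 ^ n

  P≡u*H : P ≡ u * H
  P≡u*H = trans (^-distribˡ-+-* 2 (suc e) h) (cong (u *_) (sym 4[1+t]≡2^h))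

  i<j : i < j
  i<j = m<m+n i (<-≤-trans (m^n>0 2 (suc e)) (m≤m*n u H))

  1+j≡2*H+u*H : suc j ≡ 2 * H + u * H
  1+j≡2*H+u*H = regroup t (u * H)
    where
    regroup : ∀ t U → suc (8 * t + 7 + U) ≡ 2 * (4 * suc t) + U
    regroup = solve-∀

  1+m+u≡3*u*H : suc m + u ≡ 3 * (u * H)
  1+m+u≡3*u*H = trans (cong (_+ u) 1+m≡u*[12t+11]) (triple t u)
    where
    triple : ∀ t u → u * (12 * t + 11) + u ≡ 3 * (u * (4 * suc t))
    triple = solve-∀

  i+s≡u : i + s ≡ u
  i+s≡u = m+[n∸m]≡n (≤-trans (m≤n+m i (16 * t + 14)) (subst (_≤ u) (split t) u-large))
    where
    split : ∀ t → 24 * t + 21 ≡ 16 * t + 14 + (8 * t + 7)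
    split = solve-∀

  i*m≡a*P+s : i * m ≡ a * P + s
  i*m≡a*P+s = +-cancelˡ-≡ i (i * m) (a * P + s) (begin
    i + i * m                ≡⟨ *-suc i m ⟨
    i * suc m                ≡⟨ cong (i *_) 1+m≡u*[12t+11] ⟩
    i * (u * (12 * t + 11))  ≡⟨ product t u ⟩
    a * (u * H) + u          ≡⟨ cong₂ (λ Q v → a * Q + v) (sym P≡u*H) (sym i+s≡u) ⟩
    a * P + (i + s)          ≡⟨ swap (a * P) i s ⟩
    i + (a * P + s)          ∎)
    where
    open ≡-Reasoning
    product : ∀ t u → (8 * t + 7) * (u * (12 * t + 11)) ≡ (24 * t + 19) * (u * (4 * suc t)) + u
    product = solve-∀
    swap : ∀ x y z → x + (y + z) ≡ y + (x + z)
    swap = solve-∀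

  j*m≡[a+m]*P+s : j * m ≡ (a + m) * P + s
  j*m≡[a+m]*P+s = begin
    (i + u * H) * m    ≡⟨ *-distribʳ-+ m i (u * H) ⟩
    i * m + u * H * m  ≡⟨ cong₂ (λ x Q → x + Q * m) i*m≡a*P+s (sym P≡u*H) ⟩
    a * P + s + P * m  ≡⟨ regroup a P s m ⟩
    (a + m) * P + s    ∎
    where
    open ≡-Reasoning
    regroup : ∀ a P s m → a * P + s + P * m ≡ (a + m) * P + s
    regroup = solve-∀

  s+m≤3*P : s + m ≤ 3 * P
  s+m≤3*P = subst (s + m ≤_) (begin
    s + m + suc i    ≡⟨ regroup s m i ⟩
    suc m + (i + s)  ≡⟨ cong (suc m +_) i+s≡u ⟩
    suc m + u        ≡⟨ 1+m+u≡3*u*H ⟩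
    3 * (u * H)      ≡⟨ cong (3 *_) P≡u*H ⟨
    3 * P            ∎) (m≤m+n (s + m) (suc i))
    where
    open ≡-Reasoning
    regroup : ∀ s m i → s + m + suc i ≡ suc m + (i + s)
    regroup = solve-∀

  tm-+-8*[3t+2] : ∀ x → x < 8 → tm (x + 2 ^ 3 * (3 * t + 2)) ≡ not (tm x)
  tm-+-8*[3t+2] x = tm-+-2^n*-flip 3 x (3 * t + 2) tm[3t+2]

  tm-+-u*[12t+11] : ∀ x → x < u → tm (x + u * (12 * t + 11)) ≡ not (tm x)
  tm-+-u*[12t+11] x = tm-+-2^n*-flip (suc e) x (12 * t + 11) tm[12t+11]
    where
    tm[12t+11] : tm (12 * t + 11) ≡ true
    tm[12t+11] = trans (cong tm (expand t)) (tm-+-2^n*-flip 2 3 (3 * t + 2) tm[3t+2] (s≤s (s≤s (s≤s (s≤s z≤n)))))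
      where
      expand : ∀ t → 12 * t + 11 ≡ 3 + 4 * (3 * t + 2)
      expand = solve-∀

  tm[a+δ] : ∀ δ → δ < 3 → tm (a + δ) ≡ not (tm (3 + δ))
  tm[a+δ] δ δ<3 = trans (cong tm (regroup t δ)) (tm-+-8*[3t+2] (3 + δ) (<-≤-trans (+-monoʳ-< 3 δ<3) (m≤n+m 6 2)))
    where
    regroup : ∀ t δ → 24 * t + 19 + δ ≡ 3 + δ + 8 * (3 * t + 2)
    regroup = solve-∀

  tm[a+m+δ] : ∀ δ → δ < 3 → tm (a + m + δ) ≡ tm (2 + δ)
  tm[a+m+δ] δ δ<3 = begin
    tm (a + m + δ)                            ≡⟨ cong tm far ⟩
    tm (24 * t + 18 + δ + u * (12 * t + 11))  ≡⟨ tm-+-u*[12t+11] (24 * t + 18 + δ) 24t+18+δ<u ⟩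
    not (tm (24 * t + 18 + δ))                ≡⟨ cong (λ x → not (tm x)) (near t δ) ⟩
    not (tm (2 + δ + 2 ^ 3 * (3 * t + 2)))    ≡⟨ cong not (tm-+-8*[3t+2] (2 + δ) (<-≤-trans (+-monoʳ-< 2 δ<3) (m≤n+m 5 3))) ⟩
    not (not (tm (2 + δ)))                    ≡⟨ not-involutive (tm (2 + δ)) ⟩
    tm (2 + δ)                                ∎
    where
    open ≡-Reasoning
    far : a + m + δ ≡ 24 * t + 18 + δ + u * (12 * t + 11)
    far = trans (regroup t δ (2 * r)) (cong (24 * t + 18 + δ +_) 1+m≡u*[12t+11])
      where
      regroup : ∀ t δ x → 24 * t + 19 + suc x + δ ≡ 24 * t + 18 + δ + suc (suc x)
      regroup = solve-∀
    near : ∀ t δ → 24 * t + 18 + δ ≡ 2 + δ + 8 * (3 * t + 2)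
    near = solve-∀
    24t+18+δ<u : 24 * t + 18 + δ < u
    24t+18+δ<u = <-≤-trans (+-monoʳ-< (24 * t + 18) δ<3) (subst (_≤ u) (sym (+-assoc (24 * t) 18 3)) u-large)

  agree-a-[a+m] : Agree a (a + m) 3
  agree-a-[a+m] = agreement λ δ δ<3 → begin
    tm (a + δ)              ≡⟨ tm[a+δ] δ δ<3 ⟩
    not (tm (3 + δ))        ≡⟨ cong not (tm[3+δ]≡not[tm[2+δ]] δ δ<3) ⟩
    not (not (tm (2 + δ)))  ≡⟨ not-involutive (tm (2 + δ)) ⟩
    tm (2 + δ)              ≡⟨ tm[a+m+δ] δ δ<3 ⟨
    tm (a + m + δ)          ∎
    where open ≡-Reasoning

  equal-blocks : block m i ≡ block m j
  equal-blocks = agree⇒block-≡ m i j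
    (agree-cong (sym i*m≡a*P+s) (sym j*m≡[a+m]*P+s) refl
      (agree-drop s (agree-shorten s+m≤3*P (agree-scale n agree-a-[a+m]))))

fourPowPred : ℕ → ℕ
fourPowPred zero    = 0
fourPowPred (suc g) = 3 + 4 * fourPowPred g

4*suc-fourPowPred : ∀ g → 4 * suc (fourPowPred g) ≡ 2 ^ (2 + 2 * g)
4*suc-fourPowPred zero    = refl
4*suc-fourPowPred (suc g) = begin
  4 * suc (3 + 4 * t)        ≡⟨ quadruple t ⟩
  2 * (2 * (4 * suc t))      ≡⟨ cong (λ x → 2 * (2 * x)) (4*suc-fourPowPred g) ⟩
  2 ^ (2 + (2 + 2 * g))      ≡⟨ cong (λ x → 2 ^ (2 + x)) (*-suc 2 g) ⟨
  2 ^ (2 + 2 * suc g)        ∎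
  where
  open ≡-Reasoning
  t = fourPowPred g
  quadruple : ∀ t → 4 * suc (3 + 4 * t) ≡ 2 * (2 * (4 * suc t))
  quadruple = solve-∀

g≤fourPowPred : ∀ g → g ≤ fourPowPred g
g≤fourPowPred zero    = z≤n
g≤fourPowPred (suc g) = s≤s (≤-trans (g≤fourPowPred g) (≤-trans (m≤n*m _ 4) (m≤n+m _ 2)))

tm[3*fourPowPred+2] : ∀ g → tm (3 * fourPowPred g + 2) ≡ true
tm[3*fourPowPred+2] zero    = refl
tm[3*fourPowPred+2] (suc g) =
  trans (cong tm (expand (fourPowPred g)))
        (tm-+-2^n*-flip 2 3 (3 * fourPowPred g + 2) (tm[3*fourPowPred+2] g) (s≤s (s≤s (s≤s (s≤s z≤n)))))
  where
  expand : ∀ t → 3 * (3 + 4 * t) + 2 ≡ 3 + 4 * (3 * t + 2)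
  expand = solve-∀

n<2^n : ∀ n → n < 2 ^ n
n<2^n zero    = s≤s z≤n
n<2^n (suc n) = ≤-trans (s≤s (n<2^n n)) (+-mono-≤ (m^n>0 2 n) (m≤m+n (2 ^ n) 0))

ratio-bound : ∀ p q m u H k → 0 < p → 0 < H → 2 * q ≤ H → 2 * q * (1 + 6 * H) ≤ u →
              k ≡ 2 * H + u * H → suc m + u ≡ 3 * (u * H) → 3 * q * k < m * q + p * k
ratio-bound p q m u H k 0<p 0<H 2q≤H 2q[1+6H]≤u refl 1+m+u≡3uH =
  subst (_< m * q + p * k) (sym 3qk≡mq+excess) (+-monoʳ-< (m * q) excess<pk)
  where
  open ≤-Reasoning
  excess = q * (u + (1 + 6 * H))
  3qk≡mq+excess : 3 * q * k ≡ m * q + excess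
  3qk≡mq+excess = begin-equality
    3 * q * (2 * H + u * H)            ≡⟨ spread q H u ⟩
    q * (3 * (u * H)) + q * (6 * H)    ≡⟨ cong (λ x → q * x + q * (6 * H)) 1+m+u≡3uH ⟨
    q * (suc m + u) + q * (6 * H)      ≡⟨ collect m q u H ⟩
    m * q + excess                     ∎
    where
    spread : ∀ q H u → 3 * q * (2 * H + u * H) ≡ q * (3 * (u * H)) + q * (6 * H)
    spread = solve-∀
    collect : ∀ m q u H → q * (suc m + u) + q * (6 * H) ≡ m * q + q * (u + (1 + 6 * H))
    collect = solve-∀
  excess<pk : excess < p * k
  excess<pk = *-cancelˡ-< 2 excess (p * k) (begin-strict
    2 * excess                          ≡⟨ double q u H ⟩
    2 * q * u + 2 * q * (1 + 6 * H)     ≤⟨ +-mono-≤ (subst (_≤ u * H) (*-comm u (2 * q)) (*-monoʳ-≤ u 2q≤H))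
                                                   (≤-trans 2q[1+6H]≤u (m≤m*n u H {{>-nonZero 0<H}})) ⟩
    u * H + u * H                       <⟨ +-mono-< (m<n+m (u * H) (*-monoʳ-< 2 0<H)) (m<n+m (u * H) (*-monoʳ-< 2 0<H)) ⟩
    k + k                               ≤⟨ +-mono-≤ (m≤n*m k p {{>-nonZero 0<p}}) (m≤n*m k p {{>-nonZero 0<p}}) ⟩
    p * k + p * k                       ≡⟨ cong (p * k +_) (+-identityʳ (p * k)) ⟨
    2 * (p * k)                         ∎)
    where
    double : ∀ q u H → 2 * (q * (u + (1 + 6 * H))) ≡ 2 * q * u + 2 * q * (1 + 6 * H)
    double = solve-∀

Γ>[3-p/q]k : ∀ p q → 0 < p → 0 < q → ∀ N →
             ∃[ k ] (N ≤ k × ∃[ r ] (¬ PrefixAntiPower k (suc (2 * r)) × 3 * q * k < suc (2 * r) * q + p * k))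
Γ>[3-p/q]k p q 0<p _ N =
  suc j , N≤1+j , r , ¬antiPower ,
  ratio-bound p q m u H (suc j) 0<p (s≤s z≤n) 2q≤H 2q[1+6H]≤u 1+j≡2*H+u*H 1+m+u≡3*u*H
  where
  t = fourPowPred q
  X = 24 * t + 21 + 2 * q * (1 + 6 * (4 * suc t)) + N
  r = pred (2 ^ X * (12 * t + 11))

  X≤2^[1+X] : X ≤ 2 ^ suc X
  X≤2^[1+X] = ≤-trans (<⇒≤ (n<2^n X)) (m≤m+n (2 ^ X) (2 ^ X + 0))

  1+m≡u*[12t+11] : suc (suc (2 * r)) ≡ 2 ^ suc X * (12 * t + 11)
  1+m≡u*[12t+11] = begin
    2 + 2 * r                      ≡⟨ *-suc 2 r ⟨
    2 * suc r                      ≡⟨ cong (2 *_) (suc-pred _ {{2^X*[12t+11]≢0}}) ⟩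
    2 * (2 ^ X * (12 * t + 11))    ≡⟨ *-assoc 2 (2 ^ X) _ ⟨
    2 ^ suc X * (12 * t + 11)      ∎
    where
    open ≡-Reasoning
    2^X*[12t+11]≢0 : NonZero (2 ^ X * (12 * t + 11))
    2^X*[12t+11]≢0 = m*n≢0 (2 ^ X) (12 * t + 11) {{m^n≢0 2 X}} {{>-nonZero (≤-trans (s≤s z≤n) (m≤n+m 11 (12 * t)))}}

  open EqualBlocks t (2 + 2 * q) X r (4*suc-fourPowPred q) (tm[3*fourPowPred+2] q) 1+m≡u*[12t+11]
                   (≤-trans (≤-trans (m≤m+n _ _) (m≤m+n _ N)) X≤2^[1+X])
    using (u; H; m; i; j; i<j; 1+j≡2*H+u*H; 1+m+u≡3*u*H; equal-blocks)

  ¬antiPower : ¬ PrefixAntiPower (suc j) m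
  ¬antiPower antiPower = antiPower i j (≤-trans i<j (n≤1+n j)) ≤-refl (<⇒≢ i<j) equal-blocks

  N≤1+j : N ≤ suc j
  N≤1+j = ≤-trans (m≤n+m N _) (≤-trans X≤2^[1+X] (≤-trans (m≤m*n u H) (≤-trans (m≤n+m (u * H) i) (n≤1+n j))))

  2q≤H : 2 * q ≤ H
  2q≤H = ≤-trans (*-monoʳ-≤ 2 (g≤fourPowPred q)) (widen t)
    where
    widen : ∀ t → 2 * t ≤ 4 * suc t
    widen t = subst (2 * t ≤_) (sym (*-suc 4 t)) (≤-trans (*-monoˡ-≤ t {2} {4} (s≤s (s≤s z≤n))) (m≤n+m (4 * t) 4))

  2q[1+6H]≤u : 2 * q * (1 + 6 * H) ≤ u
  2q[1+6H]≤u = ≤-trans (≤-trans (m≤n+m _ (24 * t + 21)) (m≤m+n _ N)) X≤2^[1+X]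

theorem1 : (∀ (k : ℕ) → 3 ≤ k → ∀ (r : ℕ) → ¬ PrefixAntiPower k (suc (2 * r)) → suc (2 * r) ≤ 3 * k ∸ 4)
           × (∀ (p q : ℕ) → 0 < p → 0 < q → ∀ (N : ℕ) → ∃[ k ] (N ≤ k × ∃[ r ] (¬ PrefixAntiPower k (suc (2 * r)) × 3 * q * k < suc (2 * r) * q + p * k)))
theorem1 = Γ≤3k∸4 , Γ>[3-p/q]k
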